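{- Let $G$ be a graph of order $n$ with minimum degree $\delta(G)=0$. Then $\mathcal{C}(G)=n$ if and only if $G \cong K_1 \cup K_{n-1}$ (the disjoint union of an isolated vertex and a complete graph on $n-1$ vertices).
   Context: All graphs are finite, simple (no loops or multiple edges). For a graph $G$ with vertex set $V$, a set $S\subseteq V$ is a dominating set if every vertex of $V\setminus S$ is adjacent to a vertex of $S$. Two disjoint sets $V_1,V_2\subseteq V$ form a coalition in $G$ if neither $V_1$ nor $V_2$ is a dominating set of $G$ but $V_1\cup V_2$ is. A coalition partition of $G$ is a partition $\Psi=\{V_1,\ldots,V_k\}$ of $V$ such that every $V_i\in\Psi$ is either a dominating set of $G$ with $|V_i|=1$, or is not a dominating set and forms a coalition with some $V_j\in\Psi$. The coalition number $\mathcal{C}(G)$ is the maximum cardinality of a coalition partition of $G$. The order of $G$ is $n=|V|$. -}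

module Defs where

open import Data.Nat using (ℕ; suc; _≤_)
open import Data.Fin using (Fin; zero; suc)
open import Data.Product using (Σ; ∃; _×_; _,_)
open import Data.Sum using (_⊎_)
open import Data.Empty using (⊥)
open import Relation.Nullary using (¬_)
open import Relation.Binary.PropositionalEquality using (_≡_)
open import Function.Bundles using (_↔_; Inverse)

record Graph (n : ℕ) : Set₁ where
  field
    Adj   : Fin n → Fin n → Set
    sym   : ∀ {u v} → Adj u v → Adj v u
    irrefl : ∀ {v} → ¬ Adj v v
open Graph public

VSet : ℕ → Set₁
VSet n = Fin n → Set

_∪_ : ∀ {n} → VSet n → VSet n → VSet n
(A ∪ B) v = A v ⊎ B v

Dominating : ∀ {n} → Graph n → VSet n → Set
Dominating {n} G S = (v : Fin n) → ¬ S v → Σ (Fin n) λ u → S u × Adj G u v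

MinDegreeZero : ∀ {n} → Graph n → Set
MinDegreeZero {n} G = Σ (Fin n) λ v → (u : Fin n) → ¬ Adj G u v

-- A partition of V into k (nonempty) classes: a surjective class map.
record Partition (n k : ℕ) : Set where
  field
    cls  : Fin n → Fin k
    surj : (i : Fin k) → Σ (Fin n) λ v → cls v ≡ i
open Partition public

Class : ∀ {n k} → Partition n k → Fin k → VSet n
Class P i v = cls P v ≡ i

Singleton : ∀ {n} → VSet n → Set
Singleton {n} S = Σ (Fin n) λ v → S v × ((u : Fin n) → S u → u ≡ v)

Coalition : ∀ {n} → Graph n → VSet n → VSet n → Set
Coalition G A B = ¬ Dominating G A × ¬ Dominating G B × Dominating G (A ∪ B)

IsCoalitionPartition : ∀ {n k} → Graph n → Partition n k → Set
IsCoalitionPartition {n} {k} G P =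
  (i : Fin k) →
    (Dominating G (Class P i) × Singleton (Class P i))
    ⊎ (¬ Dominating G (Class P i) ×
       Σ (Fin k) λ j → ¬ (i ≡ j) × Coalition G (Class P i) (Class P j))

CoalitionNumber : ∀ {n} → Graph n → ℕ → Set
CoalitionNumber {n} G m =
  Σ (Partition n m) (IsCoalitionPartition G)
  × (∀ k → (P : Partition n k) → IsCoalitionPartition G P → k ≤ m)

-- K₁ ∪ K_{m}: vertex zero isolated, all other distinct vertices adjacent.
K1∪K-Adj : ∀ {m} → Fin (suc m) → Fin (suc m) → Set
K1∪K-Adj zero    _       = ⊥
K1∪K-Adj (suc _) zero    = ⊥
K1∪K-Adj (suc i) (suc j) = ¬ (i ≡ j)

K1∪K : (m : ℕ) → Graph (suc m)
K1∪K m = record { Adj = K1∪K-Adj ; sym = s ; irrefl = ir }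
  where
  s : ∀ {u v : Fin (suc m)} → K1∪K-Adj u v → K1∪K-Adj v u
  s {zero} {_} ()
  s {suc _} {zero} ()
  s {suc i} {suc j} ne = λ e → ne (Relation.Binary.PropositionalEquality.sym e)
  ir : ∀ {v : Fin (suc m)} → ¬ K1∪K-Adj v v
  ir {zero} ()
  ir {suc i} ne = ne Relation.Binary.PropositionalEquality.refl

_≅_ : ∀ {n} → Graph n → Graph n → Set
_≅_ {n} G H = Σ (Fin n ↔ Fin n) λ φ →
  ∀ u v → (Adj G u v → Adj H (Inverse.to φ u) (Inverse.to φ v))
        × (Adj H (Inverse.to φ u) (Inverse.to φ v) → Adj G u v)

-- An isolated vertex v lies in every dominating set.  Hence, in a coalition
-- partition into n classes (necessarily singletons), each {u} with u ≠ v is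
-- non-dominating and its coalition partner must be {v}; as v dominates
-- nothing, {u} ∪ {v} dominating forces u to be adjacent to every other vertex
-- w ≠ v.  So G is K₁ ∪ K_{n-1}.
-- Conversely, in K₁ ∪ K_{n-1} (n ≥ 2) no single vertex dominates, while the
-- isolated vertex together with any other one does, so the singletons form a
-- coalition partition, and no partition has more than n classes.
module Submission where

open import Defs
open import Data.Nat using (ℕ; suc; zero; _≤_)
open import Data.Nat.Properties using (n<1+n)
open import Data.Product using (_×_; _,_; Σ; proj₁; proj₂)
open import Data.Sum using (_⊎_; inj₁; inj₂; [_,_]; swap)
open import Data.Empty using (⊥-elim)
open import Data.Fin using (Fin; zero; suc; punchIn; punchOut; _≟_)
open import Data.Fin.Properties
  using (injective⇒≤; <⇒notInjective; punchOut-injective; punchInᵢ≢i; suc-injective)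
open import Data.Fin.Permutation using (transpose)
open import Function using (_∘_; id)
open import Function.Bundles using (_↔_; _⇔_; mk⇔; Equivalence; Inverse; Injection)
open import Function.Properties.Equivalence using () renaming (sym to ⇔-sym; trans to ⇔-trans)
open import Function.Definitions using (Injective; StrictlySurjective)
open import Function.Properties.Inverse using (↔⇒↣)
open import Relation.Nullary using (¬_; yes; no; contradiction)
open import Relation.Nullary.Decidable using (dec-true; decidable-stable)
open import Relation.Binary.PropositionalEquality
  using (_≡_; _≢_; refl; trans; cong; subst) renaming (sym to ≡-sym)

section : ∀ {m n} {f : Fin m → Fin n} → StrictlySurjective _≡_ f → Fin n → Fin m
section surj = proj₁ ∘ surj

section-injective : ∀ {m n} {f : Fin m → Fin n} (surj : StrictlySurjective _≡_ f) →
                    Injective _≡_ _≡_ (section surj)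
section-injective {f = f} surj {i} {j} eq =
  trans (≡-sym (proj₂ (surj i))) (trans (cong f eq) (proj₂ (surj j)))

surjective⇒≤ : ∀ {m n} {f : Fin m → Fin n} → StrictlySurjective _≡_ f → n ≤ m
surjective⇒≤ surj = injective⇒≤ (section-injective surj)

-- If f identified u ≠ w, the section would miss u or w and so, after
-- punching out the missed point, inject Fin (suc p) into Fin p.
surjective⇒injective : ∀ {n} {f : Fin n → Fin n} → StrictlySurjective _≡_ f →
                       Injective _≡_ _≡_ f
surjective⇒injective {zero} _ {()}
surjective⇒injective {suc p} {f} surj {u} {w} fu≡fw with u ≟ w
... | yes u≡w = u≡w
... | no  u≢w =
  contradiction (λ {x y} → punched-section-injective {x} {y}) (<⇒notInjective (n<1+n p))
  where
  s = section surj

  s∘f-fixes-image : ∀ {x} i → x ≡ s i → s (f x) ≡ x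
  s∘f-fixes-image i refl = cong s (proj₂ (surj i))

  missed : Σ (Fin (suc p)) λ x → ∀ i → x ≢ s i
  missed with s (f u) ≟ u
  ... | no  s[fu]≢u = u , λ i → s[fu]≢u ∘ s∘f-fixes-image i
  ... | yes s[fu]≡u = w , λ i w≡si →
          u≢w (trans (≡-sym s[fu]≡u) (trans (cong s fu≡fw) (s∘f-fixes-image i w≡si)))

  avoids : ∀ i → proj₁ missed ≢ s i
  avoids = proj₂ missed

  punched-section : Fin (suc p) → Fin p
  punched-section i = punchOut (avoids i)

  punched-section-injective : Injective _≡_ _≡_ punched-section
  punched-section-injective = section-injective surj ∘ punchOut-injective (avoids _) (avoids _)

Isolated : ∀ {n} → Graph n → Fin n → Set
Isolated {n} G v = (u : Fin n) → ¬ Adj G u v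

isolated∈dominating : ∀ {n} (G : Graph n) {S : VSet n} {v} →
                      Isolated G v → Dominating G S → ¬ ¬ S v
isolated∈dominating G v-isolated dom v∉S with dom _ v∉S
... | x , _ , adj = v-isolated x adj

DistinctAvoiding : ∀ {n} → Fin n → Fin n → Fin n → Set
DistinctAvoiding c u w = u ≢ c × w ≢ c × u ≢ w

IsK1∪K : ∀ {n} → Graph n → Fin n → Set
IsK1∪K {n} G c = (u w : Fin n) → Adj G u w ⇔ DistinctAvoiding c u w

K1∪K-isK1∪K : ∀ m → IsK1∪K (K1∪K m) zero
K1∪K-isK1∪K m zero    w       = mk⇔ (λ ()) (λ (0≢0 , _) → contradiction refl 0≢0)
K1∪K-isK1∪K m (suc i) zero    = mk⇔ (λ ()) (λ (_ , 0≢0 , _) → contradiction refl 0≢0)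
K1∪K-isK1∪K m (suc i) (suc j) =
  mk⇔ (λ i≢j → (λ ()) , (λ ()) , i≢j ∘ suc-injective)
      (λ (_ , _ , i≢j) → i≢j ∘ cong suc)

adjacent⇒distinct-avoiding : ∀ {n} (G : Graph n) {c u w} →
                             Isolated G c → Adj G u w → DistinctAvoiding c u w
adjacent⇒distinct-avoiding G c-isolated adj =
    (λ { refl → c-isolated _ (sym G adj) })
  , (λ { refl → c-isolated _ adj })
  , (λ { refl → irrefl G adj })

distinct-avoiding-injective : ∀ {n} {f : Fin n → Fin n} → Injective _≡_ _≡_ f →
                              ∀ {c d u w} → f c ≡ d →
                              DistinctAvoiding c u w ⇔ DistinctAvoiding d (f u) (f w)
distinct-avoiding-injective {f = f} f-injective refl = mk⇔
  (λ (u≢c , w≢c , u≢w) → u≢c ∘ f-injective , w≢c ∘ f-injective , u≢w ∘ f-injective)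
  (λ (u≢c , w≢c , u≢w) → u≢c ∘ cong f , w≢c ∘ cong f , u≢w ∘ cong f)

↔-injective : ∀ {n} (φ : Fin n ↔ Fin n) → Injective _≡_ _≡_ (Inverse.to φ)
↔-injective φ = Injection.injective (↔⇒↣ φ)

adj⇔-≅ : ∀ {n} {G H : Graph n} ((φ , _) : G ≅ H) → let open Inverse φ in
         ∀ u w → Adj G u w ⇔ Adj H (to u) (to w)
adj⇔-≅ (_ , φ-iso) u w = mk⇔ (proj₁ (φ-iso u w)) (proj₂ (φ-iso u w))

IsK1∪K-≅ : ∀ {n} {G H : Graph n} {d} ((φ , _) : G ≅ H) →
           IsK1∪K H d → IsK1∪K G (Inverse.from φ d)
IsK1∪K-≅ {G = G} {H} {d} G≅H@(φ , _) H-shape u w =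
  ⇔-trans (adj⇔-≅ {G = G} {H} G≅H u w)
    (⇔-trans (H-shape _ _)
      (⇔-sym (distinct-avoiding-injective (↔-injective φ) (Inverse.strictlyInverseˡ φ d))))

IsK1∪K⇒≅ : ∀ {n} {G H : Graph n} {c d} → IsK1∪K G c → IsK1∪K H d → G ≅ H
IsK1∪K⇒≅ {G = G} {H} {c} {d} G-shape H-shape =
  π , λ u w → Equivalence.to (adj⇔ u w) , Equivalence.from (adj⇔ u w)
  where
  π = transpose c d
  open Inverse π using (to)

  to-c : to c ≡ d
  to-c rewrite dec-true (c ≟ c) refl = refl

  adj⇔ : ∀ u w → Adj G u w ⇔ Adj H (to u) (to w)
  adj⇔ u w = ⇔-trans (G-shape u w)
    (⇔-trans (distinct-avoiding-injective (↔-injective π) to-c) (⇔-sym (H-shape _ _)))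

isolated-partner : ∀ {n k} (G : Graph n) (P : Partition n k) {v i} →
                   Isolated G v → IsCoalitionPartition G P → ¬ Class P i v →
                   Dominating G (Class P i ∪ Class P (cls P v))
isolated-partner G P {v} {i} v-isolated cp v∉i with cp i
... | inj₁ (dom , _) = ⊥-elim (isolated∈dominating G v-isolated dom v∉i)
... | inj₂ (_ , j , _ , _ , _ , dom) =
  subst (λ j → Dominating G (Class P i ∪ Class P j)) (≡-sym v∈j) dom
  where
  v∈j : cls P v ≡ j
  v∈j = decidable-stable (cls P v ≟ j) λ v∉j →
          isolated∈dominating G v-isolated dom [ v∉i , v∉j ]

singleton-coalition-partition⇒IsK1∪K : ∀ {n} (G : Graph n) {v} → Isolated G v →
  (P : Partition n n) → IsCoalitionPartition G P → IsK1∪K G v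
singleton-coalition-partition⇒IsK1∪K G {v} v-isolated P cp u w =
  mk⇔ (adjacent⇒distinct-avoiding G v-isolated) adjacent
  where
  cls-injective : Injective _≡_ _≡_ (cls P)
  cls-injective = surjective⇒injective (surj P)

  adjacent : DistinctAvoiding v u w → Adj G u w
  adjacent (u≢v , w≢v , u≢w)
    with isolated-partner G P v-isolated cp (u≢v ∘ ≡-sym ∘ cls-injective) w
           [ u≢w ∘ ≡-sym ∘ cls-injective , w≢v ∘ cls-injective ]
  ... | x , inj₁ x∈u , adj = subst (λ y → Adj G y w) (cls-injective x∈u) adj
  ... | x , inj₂ x∈v , adj =
    ⊥-elim (v-isolated w (sym G (subst (λ y → Adj G y w) (cls-injective x∈v) adj)))

singletons : ∀ {n} → Partition n n
singletons = record { cls = id ; surj = λ i → i , refl }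

dominating-singleton⇒adjacent : ∀ {n} (G : Graph n) {i w} →
                                Dominating G (_≡ i) → w ≢ i → Adj G i w
dominating-singleton⇒adjacent G dom w≢i with dom _ w≢i
... | _ , refl , adj = adj

companion : ∀ {m} (c i : Fin (suc (suc m))) →
            Σ (Fin (suc (suc m))) λ j → j ≢ i × (i ≡ c ⊎ j ≡ c)
companion c i with i ≟ c
... | yes i≡c = punchIn i zero , punchInᵢ≢i i zero , inj₁ i≡c
... | no  i≢c = c , i≢c ∘ ≡-sym , inj₂ refl

module _ {n} (G : Graph n) {c} (shape : IsK1∪K G c)
         {i j : Fin n} (j≢i : j ≢ i) (c∈ij : i ≡ c ⊎ j ≡ c) where

  singleton-not-dominating : ¬ Dominating G (_≡ i)
  singleton-not-dominating dom
    with Equivalence.to (shape i j) (dominating-singleton⇒adjacent G dom j≢i)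
  ... | i≢c , j≢c , _ = [ i≢c , j≢c ] c∈ij

  pair-dominating : Dominating G ((_≡ i) ∪ (_≡ j))
  pair-dominating v v∉ij = [ dominated-by-j , dominated-by-i ] c∈ij
    where
    dominated-by-j : i ≡ c → Σ (Fin n) λ x → (x ≡ i ⊎ x ≡ j) × Adj G x v
    dominated-by-j i≡c = j , inj₂ refl , Equivalence.from (shape j v)
      ( (λ j≡c → j≢i (trans j≡c (≡-sym i≡c)))
      , (λ v≡c → v∉ij (inj₁ (trans v≡c (≡-sym i≡c))))
      , v∉ij ∘ inj₂ ∘ ≡-sym )

    dominated-by-i : j ≡ c → Σ (Fin n) λ x → (x ≡ i ⊎ x ≡ j) × Adj G x v
    dominated-by-i j≡c = i , inj₁ refl , Equivalence.from (shape i v)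
      ( (λ i≡c → j≢i (trans j≡c (≡-sym i≡c)))
      , (λ v≡c → v∉ij (inj₂ (trans v≡c (≡-sym j≡c))))
      , v∉ij ∘ inj₁ ∘ ≡-sym )

IsK1∪K⇒singletons-coalition-partition : ∀ {m} (G : Graph (suc m)) {c} → IsK1∪K G c →
                                         IsCoalitionPartition G singletons
IsK1∪K⇒singletons-coalition-partition {zero} _ _ zero =
  inj₁ ((λ { zero 0≢0 → contradiction refl 0≢0 }) , zero , refl , λ _ u≡0 → u≡0)
IsK1∪K⇒singletons-coalition-partition {suc _} G {c} shape i with companion c i
... | j , j≢i , c∈ij =
  inj₂ (singleton-not-dominating G shape j≢i c∈ij , j , j≢i ∘ ≡-sym ,
        singleton-not-dominating G shape j≢i c∈ij ,
        singleton-not-dominating G shape (j≢i ∘ ≡-sym) (swap c∈ij) ,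
        pair-dominating G shape j≢i c∈ij)

IsK1∪K⇒CoalitionNumber : ∀ {m} (G : Graph (suc m)) {c} →
                         IsK1∪K G c → CoalitionNumber G (suc m)
IsK1∪K⇒CoalitionNumber G shape =
    (singletons , IsK1∪K⇒singletons-coalition-partition G shape)
  , λ _ P _ → surjective⇒≤ (surj P)

theorem4 : (m : ℕ) (G : Graph (suc m)) → MinDegreeZero G →
    (CoalitionNumber G (suc m) → G ≅ K1∪K m) × (G ≅ K1∪K m → CoalitionNumber G (suc m))
theorem4 m G (v , v-isolated) = only-if , if
  where
  only-if : CoalitionNumber G (suc m) → G ≅ K1∪K m
  only-if ((P , cp) , _) =
    IsK1∪K⇒≅ {G = G} {K1∪K m}
      (singleton-coalition-partition⇒IsK1∪K G v-isolated P cp) (K1∪K-isK1∪K m)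

  if : G ≅ K1∪K m → CoalitionNumber G (suc m)
  if G≅K = IsK1∪K⇒CoalitionNumber G (IsK1∪K-≅ {G = G} {K1∪K m} G≅K (K1∪K-isK1∪K m))
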